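{- The language $Q_I$ is dense over $V$: for every $w \in V^*$ there exist $x, y \in V^*$ such that $x w y \in Q_I$.
   Context: $V$ is a finite alphabet with at least two distinct letters; $V^*$ is the set of all finite words over $V$ (including the empty word). A nonempty word $w$ is primitive if it is not of the form $v^n$ for a word $v$ and an integer $n \ge 2$. For a word $w$ of length $n$, $w[1..i]$ denotes its prefix of length $i$ and $w[i+1..n]$ its suffix of length $n-i$. A primitive word $w$ of length $n$ is ins-robust if for every $i \in \{0,\ldots,n\}$ and every $a \in V$ the word $w[1..i]\,a\,w[i+1..n]$ is primitive; $Q_I$ is the set of ins-robust primitive words over $V$. -}

module Defs where

open import Data.Nat using (ℕ; _≤_)
open import Data.Fin using (Fin)
open import Data.List using (List; []; _∷_; _++_; concat; replicate; take; drop; length)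
open import Data.Product using (∃; ∃-syntax; _×_)
open import Relation.Binary.PropositionalEquality using (_≡_; _≢_)
open import Relation.Nullary using (¬_)

-- The alphabet V is Fin k (a finite set with k letters); words are lists.
Word : ℕ → Set
Word k = List (Fin k)

_^ʷ_ : {A : Set} → List A → ℕ → List A
v ^ʷ n = concat (replicate n v)

Primitive : {A : Set} → List A → Set
Primitive w = (w ≢ []) × ¬ (∃[ v ] ∃[ n ] (2 ≤ n × w ≡ v ^ʷ n))

insertAt : {A : Set} → ℕ → A → List A → List A
insertAt i a w = take i w ++ (a ∷ drop i w)

InsRobust : {A : Set} → List A → Set
InsRobust {A} w = Primitive w × ((i : ℕ) → i ≤ length w → (a : A) → Primitive (insertAt i a w))

-- A word in which two letters occur coprimely often is primitive, since a
-- factorisation w = vⁿ multiplies every letter count by n. Inserting a letter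
-- raises at most one of these two counts by one, so it suffices to pad w with
-- the two letters until their counts p, q make (p, q), (p + 1, q) and
-- (p, q + 1) coprime pairs. If the letters occur a and b times in w, then
-- q = 2b + 1 and p = 1 + q(q + 1)a do this.
module Submission where

open import Defs
open import Data.Nat using (ℕ; zero; suc; _+_; _*_; _∸_; _≤_; s≤s)
open import Data.Nat.Properties using (+-comm; +-identityʳ; m∸n+n≡m; m+[n∸m]≡n; m≤n*m; m≤m+n; ≤-trans; n≤1+n)
open import Data.Nat.Divisibility using (_∣_; ∣1⇒≡1; ∣-trans; ∣m+n∣m⇒∣n; m∣m*n; n∣m*n; divides)
open import Data.Nat.Coprimality using (Coprime; 1-coprimeTo)
open import Data.Fin using (Fin; zero; suc)
open import Data.Fin.Properties using (_≟_)
open import Data.List using (List; []; _∷_; _++_; replicate; take; drop; filter; length)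
open import Data.List.Properties using (length-++; filter-++; filter-accept; filter-reject; take++drop≡id)
open import Data.List.Relation.Binary.Permutation.Propositional using (_↭_)
open import Data.List.Relation.Binary.Permutation.Propositional.Properties using (↭-length; filter-↭; shift)
open import Data.Product using (∃-syntax; _,_; _×_)
open import Relation.Binary.Definitions using (DecidableEquality)
open import Relation.Nullary using (¬_; Dec; yes; no)
open import Function using (_∘_)
open import Relation.Binary.PropositionalEquality
  using (_≡_; _≢_; refl; sym; trans; cong; cong₂; subst; subst₂; module ≡-Reasoning)

coprime-+-multiple : ∀ {r n m} → Coprime r n → n ∣ m → Coprime (r + m) n
coprime-+-multiple {r} {n} {m} r⊥n n∣m {d} (d∣r+m , d∣n) =
  r⊥n (∣m+n∣m⇒∣n (subst (d ∣_) (+-comm r m) d∣r+m) (∣-trans d∣n n∣m) , d∣n)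

2-coprime-odd : ∀ s → Coprime 2 (1 + 2 * s)
2-coprime-odd s {d} (d∣2 , d∣1+2s) =
  ∣1⇒≡1 (∣m+n∣m⇒∣n (subst (d ∣_) (+-comm 1 (2 * s)) d∣1+2s) (∣-trans d∣2 (m∣m*n s)))

module Occurrences {A : Set} (_≟ᴬ_ : DecidableEquality A) where

  occ : A → List A → ℕ
  occ c w = length (filter (c ≟ᴬ_) w)

  occ-++ : ∀ c xs ys → occ c (xs ++ ys) ≡ occ c xs + occ c ys
  occ-++ c xs ys = trans (cong length (filter-++ (c ≟ᴬ_) xs ys)) (length-++ (filter (c ≟ᴬ_) xs))

  occ-^ : ∀ c v n → occ c (v ^ʷ n) ≡ n * occ c v
  occ-^ c v zero    = refl
  occ-^ c v (suc n) = trans (occ-++ c v (v ^ʷ n)) (cong (occ c v +_) (occ-^ c v n))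

  occ-↭ : ∀ c {xs ys} → xs ↭ ys → occ c xs ≡ occ c ys
  occ-↭ c xs↭ys = ↭-length (filter-↭ (c ≟ᴬ_) xs↭ys)

  occ-insertAt : ∀ c i a w → occ c (insertAt i a w) ≡ occ c (a ∷ w)
  occ-insertAt c i a w =
    trans (occ-↭ c (shift a (take i w) (drop i w))) (cong (λ u → occ c (a ∷ u)) (take++drop≡id i w))

  occ-∷-self : ∀ c w → occ c (c ∷ w) ≡ suc (occ c w)
  occ-∷-self c w = cong length (filter-accept (c ≟ᴬ_) refl)

  occ-∷-other : ∀ {c e} w → c ≢ e → occ c (e ∷ w) ≡ occ c w
  occ-∷-other {c} w c≢e = cong length (filter-reject (c ≟ᴬ_) c≢e)

  occ-replicate-self : ∀ c n → occ c (replicate n c) ≡ n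
  occ-replicate-self c zero    = refl
  occ-replicate-self c (suc n) = trans (occ-∷-self c (replicate n c)) (cong suc (occ-replicate-self c n))

  occ-replicate-other : ∀ {c e} n → c ≢ e → occ c (replicate n e) ≡ 0
  occ-replicate-other zero    c≢e = refl
  occ-replicate-other (suc n) c≢e = trans (occ-∷-other (replicate n _) c≢e) (occ-replicate-other n c≢e)

  coprime-occ⇒primitive : ∀ {c d w} → Coprime (occ c w) (occ d w) → Primitive w
  coprime-occ⇒primitive {c} {d} {w} c⊥d = nonempty , not-power
    where
    nonempty : w ≢ []
    nonempty refl with () ← c⊥d {2} (divides 0 refl , divides 0 refl)

    ∣occ : ∀ {v n} e → w ≡ v ^ʷ n → n ∣ occ e w
    ∣occ {v} {n} e refl = subst (n ∣_) (sym (occ-^ e v n)) (m∣m*n (occ e v))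

    not-power : ¬ (∃[ v ] ∃[ n ] (2 ≤ n × w ≡ v ^ʷ n))
    not-power (v , n , 2≤n , w≡vⁿ) with refl ← c⊥d {n} (∣occ c w≡vⁿ , ∣occ d w≡vⁿ) | s≤s () ← 2≤n

  insRobust-by-occ : ∀ {c d w} → c ≢ d →
    Coprime (occ c w) (occ d w) →
    Coprime (suc (occ c w)) (occ d w) →
    Coprime (occ c w) (suc (occ d w)) →
    InsRobust w
  insRobust-by-occ {c} {d} {w} c≢d c⊥d 1+c⊥d c⊥1+d =
    coprime-occ⇒primitive c⊥d , λ i _ e → coprime-occ⇒primitive (after-insert i e)
    where
    after-insert : ∀ i e → Coprime (occ c (insertAt i e w)) (occ d (insertAt i e w))
    after-insert i e = subst₂ Coprime (sym (occ-insertAt c i e w)) (sym (occ-insertAt d i e w))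
                                      (after-cons e (c ≟ᴬ e) (d ≟ᴬ e))
      where
      after-cons : ∀ e → Dec (c ≡ e) → Dec (d ≡ e) → Coprime (occ c (e ∷ w)) (occ d (e ∷ w))
      after-cons _ (yes refl) _ =
        subst₂ Coprime (sym (occ-∷-self c w)) (sym (occ-∷-other w (c≢d ∘ sym))) 1+c⊥d
      after-cons _ (no c≢e) (yes refl) =
        subst₂ Coprime (sym (occ-∷-other w c≢e)) (sym (occ-∷-self d w)) c⊥1+d
      after-cons _ (no c≢e) (no d≢e) =
        subst₂ Coprime (sym (occ-∷-other w c≢e)) (sym (occ-∷-other w d≢e)) c⊥d

  pad : A → ℕ → A → ℕ → List A → List A
  pad c p d q w = replicate (p ∸ occ c w) c ++ w ++ replicate (q ∸ occ d w) d

  module _ {c d : A} (c≢d : c ≢ d) {p q : ℕ} (w : List A) where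
    open ≡-Reasoning

    occ-pad-left : occ c w ≤ p → occ c (pad c p d q w) ≡ p
    occ-pad-left a≤p = begin
      occ c (pad c p d q w)
        ≡⟨ occ-++ c (replicate (p ∸ occ c w) c) _ ⟩
      occ c (replicate (p ∸ occ c w) c) + occ c (w ++ replicate (q ∸ occ d w) d)
        ≡⟨ cong₂ _+_ (occ-replicate-self c (p ∸ occ c w)) (occ-++ c w _) ⟩
      (p ∸ occ c w) + (occ c w + occ c (replicate (q ∸ occ d w) d))
        ≡⟨ cong (λ z → (p ∸ occ c w) + (occ c w + z)) (occ-replicate-other (q ∸ occ d w) c≢d) ⟩
      (p ∸ occ c w) + (occ c w + 0)
        ≡⟨ cong ((p ∸ occ c w) +_) (+-identityʳ (occ c w)) ⟩
      (p ∸ occ c w) + occ c w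
        ≡⟨ m∸n+n≡m a≤p ⟩
      p ∎

    occ-pad-right : occ d w ≤ q → occ d (pad c p d q w) ≡ q
    occ-pad-right b≤q = begin
      occ d (pad c p d q w)
        ≡⟨ occ-++ d (replicate (p ∸ occ c w) c) _ ⟩
      occ d (replicate (p ∸ occ c w) c) + occ d (w ++ replicate (q ∸ occ d w) d)
        ≡⟨ cong₂ _+_ (occ-replicate-other (p ∸ occ c w) (c≢d ∘ sym)) (occ-++ d w _) ⟩
      occ d w + occ d (replicate (q ∸ occ d w) d)
        ≡⟨ cong (occ d w +_) (occ-replicate-self d (q ∸ occ d w)) ⟩
      occ d w + (q ∸ occ d w)
        ≡⟨ m+[n∸m]≡n b≤q ⟩
      q ∎

  insRobust-pad : ∀ {c d p q} → c ≢ d → (w : List A) → occ c w ≤ p → occ d w ≤ q →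
    Coprime p q → Coprime (suc p) q → Coprime p (suc q) → InsRobust (pad c p d q w)
  insRobust-pad {c} {d} {p} {q} c≢d w a≤p b≤q p⊥q 1+p⊥q p⊥1+q =
    insRobust-by-occ c≢d
      (subst₂ Coprime (sym occ-c) (sym occ-d) p⊥q)
      (subst₂ Coprime (cong suc (sym occ-c)) (sym occ-d) 1+p⊥q)
      (subst₂ Coprime (sym occ-c) (cong suc (sym occ-d)) p⊥1+q)
    where
    occ-c : occ c (pad c p d q w) ≡ p
    occ-c = occ-pad-left c≢d w a≤p
    occ-d : occ d (pad c p d q w) ≡ q
    occ-d = occ-pad-right c≢d w b≤q

module RobustCounts (a b : ℕ) where
  q : ℕ
  q = 1 + 2 * b

  p : ℕ
  p = 1 + q * (1 + q) * a

  a≤p : a ≤ p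
  a≤p = ≤-trans (m≤n*m a (q * (1 + q))) (n≤1+n _)

  b≤q : b ≤ q
  b≤q = ≤-trans (m≤m+n b (b + 0)) (n≤1+n _)

  p⊥q : Coprime p q
  p⊥q = coprime-+-multiple {1} (1-coprimeTo q) (∣-trans (m∣m*n (1 + q)) (m∣m*n a))

  1+p⊥q : Coprime (suc p) q
  1+p⊥q = coprime-+-multiple {2} (2-coprime-odd b) (∣-trans (m∣m*n (1 + q)) (m∣m*n a))

  p⊥1+q : Coprime p (suc q)
  p⊥1+q = coprime-+-multiple {1} (1-coprimeTo (suc q)) (∣-trans (n∣m*n q) (m∣m*n a))

theorem17 : (k : ℕ) → 2 ≤ k → (w : List (Fin k)) → ∃[ x ] ∃[ y ] InsRobust (x ++ w ++ y)
theorem17 (suc (suc k)) (s≤s (s≤s _)) w =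
  replicate (p ∸ occ zero w) zero , replicate (q ∸ occ (suc zero) w) (suc zero) ,
  insRobust-pad (λ ()) w a≤p b≤q p⊥q 1+p⊥q p⊥1+q
  where
  open Occurrences _≟_
  open RobustCounts (occ zero w) (occ (suc zero) w)
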